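{- For every positive integer $n$, $$\vartheta_2\Big(\sum_{k=1}^{n} \frac{2^k}{k}\Big) \geq s_2(n)$$ and, more strongly, $$\vartheta_2\Big(\sum_{k=1}^{n} \frac{2^k}{k}\Big) \geq n - \Big\lfloor \frac{\log n}{\log 2} \Big\rfloor.$$
   Context: $\vartheta_2$ denotes the $2$-adic valuation, extended to nonzero rational numbers by $\vartheta_2(a/b) = \vartheta_2(a) - \vartheta_2(b)$. $s_2(n)$ denotes the sum of the binary digits of $n$. $\lfloor x \rfloor$ denotes the integer part of $x$. -}

module Defs where

open import Data.Nat using (ℕ; zero; suc; _^_)
open import Data.Nat.DivMod using (_/_; _%_)
open import Data.Integer as ℤ using (ℤ; +_; _-_; ∣_∣)
open import Data.Rational as ℚ using (ℚ)

-- 2-adic valuation of a natural number m ≥ 1 (largest e with 2^e ∣ m),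
-- computed by repeated halving with fuel m (enough since ν₂ m ≤ m).
-- For m = 0 the value is a junk value (it is never used for 0 below).
ν₂-fuel : ℕ → ℕ → ℕ
ν₂-fuel zero    m = zero
ν₂-fuel (suc f) zero = zero
ν₂-fuel (suc f) m@(suc _) with m % 2
... | zero  = suc (ν₂-fuel f (m / 2))
... | suc _ = zero

ν₂ : ℕ → ℕ
ν₂ m = ν₂-fuel m m

-- 2-adic valuation of a nonzero rational a/b (in lowest terms):
-- ϑ₂(a/b) = ϑ₂(a) - ϑ₂(b).  (Junk value 0 at q = 0.)
ν₂ℚ : ℚ → ℤ
ν₂ℚ q = + ν₂ ∣ ℚ.numerator q ∣ - + ν₂ (ℚ.denominatorℕ q)

s₂-fuel : ℕ → ℕ → ℕ
s₂-fuel zero    m = zero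
s₂-fuel (suc f) m = m % 2 Data.Nat.+ s₂-fuel f (m / 2)

s₂ : ℕ → ℕ
s₂ n = s₂-fuel n n

term : ℕ → ℚ
term j = (+ (2 ^ suc j)) ℚ./ suc j

S : ℕ → ℚ
S zero    = ℚ.0ℚ
S (suc n) = S n ℚ.+ term n

{-# OPTIONS --safe #-}
module Submission where

-- Write T(i, j) = i! j! / (i+j+1)! for the entries of Leibniz's harmonic triangle. Both sides of
-- ∑_{k=1}^{n} 2^k / k = 2^n ∑_{i+j=n-1} T(i, j) obey the same recurrence in n. The triangle rule
-- T(i, j+1) = T(i, j) − T(i+1, j), started from T(i, 0) = 1/(i+1), shows by induction on j that
-- ϑ₂(T(i, j)) ≥ −⌊log₂(i+j+1)⌋, because ϑ₂(m) ≤ ⌊log₂ m⌋ and ⌊log₂⌋ is monotone. Hence ϑ₂ of the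
-- sum is at least n − ⌊log₂ n⌋, and halving n shows s₂(n) + ⌊log₂ n⌋ ≤ n.

open import Defs

module Valuation where

  open import Data.Nat
  open import Data.Nat.Properties
  open import Data.Nat.DivMod
  open import Data.Nat.Divisibility
  open import Data.Nat.Induction using (<-wellFounded; Acc; acc)
  open import Data.Nat.Logarithm using (⌊log₂_⌋; ⌊log₂⌋-mono-≤; ⌊log₂[2^n]⌋≡n)
  open import Data.Nat.Tactic.RingSolver using (solve-∀)
  open import Function using (_∘_)
  open import Relation.Binary.PropositionalEquality

  ν₂-fuel-zero : ∀ f → ν₂-fuel f 0 ≡ 0
  ν₂-fuel-zero zero    = refl
  ν₂-fuel-zero (suc f) = refl

  ν₂-fuel-irrelevant : ∀ {f g} m → m ≤ f → m ≤ g → ν₂-fuel f m ≡ ν₂-fuel g m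
  ν₂-fuel-irrelevant {f} {g} zero _ _ = trans (ν₂-fuel-zero f) (sym (ν₂-fuel-zero g))
  ν₂-fuel-irrelevant {suc f} {suc g} m@(suc _) m≤1+f m≤1+g with m % 2
  ... | zero  = cong suc (ν₂-fuel-irrelevant (m / 2) (half≤ m≤1+f) (half≤ m≤1+g))
    where
    half≤ : ∀ {h} → m ≤ suc h → m / 2 ≤ h
    half≤ m≤1+h = <⇒≤pred (<-≤-trans (m/n<m m 2 (s≤s (s≤s z≤n))) m≤1+h)
  ... | suc _ = refl

  ν₂-fuel-double : ∀ f m .{{_ : NonZero m}} → ν₂-fuel (suc f) (2 * m) ≡ suc (ν₂-fuel f m)
  ν₂-fuel-double f m@(suc _) with (2 * m) % 2 | trans (cong (_% 2) (*-comm 2 m)) (m*n%n≡0 m 2)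
  ... | .0 | refl = cong (suc ∘ ν₂-fuel f) (trans (cong (_/ 2) (*-comm 2 m)) (m*n/n≡m m 2))

  ν₂-double : ∀ m .{{_ : NonZero m}} → ν₂ (2 * m) ≡ suc (ν₂ m)
  ν₂-double m@(suc k) =
    trans (ν₂-fuel-double _ m) (cong suc (ν₂-fuel-irrelevant m m≤2m-1 ≤-refl))
    where
    m≤2m-1 : m ≤ k + 1 * m
    m≤2m-1 = ≤-trans (m≤n+m m k) (≤-reflexive (cong (k +_) (sym (*-identityˡ m))))

  ν₂-odd : ∀ k → ν₂ (1 + 2 * k) ≡ 0
  ν₂-odd k with (1 + 2 * k) % 2 | trans (cong (λ x → (1 + x) % 2) (*-comm 2 k)) ([m+kn]%n≡m%n 1 k 2)
  ... | .1 | refl = refl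

  data Dyadic : ℕ → Set where
    odd    : ∀ k → Dyadic (1 + 2 * k)
    double : ∀ {m} → Dyadic m → Dyadic (2 * m)

  dyadic-nonZero : ∀ {m} → Dyadic m → NonZero m
  dyadic-nonZero (odd k)    = _
  dyadic-nonZero (double d) = m*n≢0 2 _ {{_}} {{dyadic-nonZero d}}

  dyadic : ∀ m .{{_ : NonZero m}} → Dyadic m
  dyadic m = go m (<-wellFounded m)
    where
    go : ∀ m .{{_ : NonZero m}} → Acc _<_ m → Dyadic m
    go m (acc rec) with m % 2 | m≡m%n+[m/n]*n m 2 | m%n<n m 2
    ... | 1 | m≡1+h*2 | _ = subst Dyadic (sym (trans m≡1+h*2 (cong (1 +_) (*-comm (m / 2) 2)))) (odd (m / 2))
    ... | 0 | m≡h*2   | _ = subst Dyadic (sym (trans m≡h*2 (*-comm (m / 2) 2))) (double (go (m / 2) {{h≢0}} (rec h<m)))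
      where
      h≢0 : NonZero (m / 2)
      h≢0 = ≢-nonZero λ h≡0 → ≢-nonZero⁻¹ m (trans m≡h*2 (cong (_* 2) h≡0))
      h<m : m / 2 < m
      h<m = m/n<m m 2 (s≤s (s≤s z≤n))
    ... | 2+ _ | _ | s≤s (s≤s ())

  ν₂-*-dyadic : ∀ {m n} → Dyadic m → Dyadic n → ν₂ (m * n) ≡ ν₂ m + ν₂ n
  ν₂-*-dyadic (odd k) (odd l) = begin
    ν₂ ((1 + 2 * k) * (1 + 2 * l))  ≡⟨ cong ν₂ (odd-* k l) ⟩
    ν₂ (1 + 2 * (k + l + 2 * k * l)) ≡⟨ ν₂-odd (k + l + 2 * k * l) ⟩
    0                                ≡⟨ cong₂ _+_ (ν₂-odd k) (ν₂-odd l) ⟨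
    ν₂ (1 + 2 * k) + ν₂ (1 + 2 * l)  ∎
    where
    open ≡-Reasoning
    odd-* : ∀ k l → (1 + 2 * k) * (1 + 2 * l) ≡ 1 + 2 * (k + l + 2 * k * l)
    odd-* = solve-∀
  ν₂-*-dyadic {m} (odd k) (double {n} dn) = begin
    ν₂ (m * (2 * n))     ≡⟨ cong ν₂ (swap m n) ⟩
    ν₂ (2 * (m * n))     ≡⟨ ν₂-double (m * n) {{m*n≢0 m n {{_}} {{dyadic-nonZero dn}}}} ⟩
    suc (ν₂ (m * n))     ≡⟨ cong suc (ν₂-*-dyadic (odd k) dn) ⟩
    suc (ν₂ m + ν₂ n)    ≡⟨ +-suc (ν₂ m) (ν₂ n) ⟨
    ν₂ m + suc (ν₂ n)    ≡⟨ cong (ν₂ m +_) (ν₂-double n {{dyadic-nonZero dn}}) ⟨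
    ν₂ m + ν₂ (2 * n)    ∎
    where
    open ≡-Reasoning
    swap : ∀ m n → m * (2 * n) ≡ 2 * (m * n)
    swap = solve-∀
  ν₂-*-dyadic {n = n} (double {m} dm) dn = begin
    ν₂ (2 * m * n)       ≡⟨ cong ν₂ (*-assoc 2 m n) ⟩
    ν₂ (2 * (m * n))     ≡⟨ ν₂-double (m * n) {{m*n≢0 m n {{dyadic-nonZero dm}} {{dyadic-nonZero dn}}}} ⟩
    suc (ν₂ (m * n))     ≡⟨ cong suc (ν₂-*-dyadic dm dn) ⟩
    suc (ν₂ m + ν₂ n)    ≡⟨ cong (_+ ν₂ n) (ν₂-double m {{dyadic-nonZero dm}}) ⟨
    ν₂ (2 * m) + ν₂ n    ∎
    where open ≡-Reasoning

  ν₂-* : ∀ m n .{{_ : NonZero m}} .{{_ : NonZero n}} → ν₂ (m * n) ≡ ν₂ m + ν₂ n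
  ν₂-* m n = ν₂-*-dyadic (dyadic m) (dyadic n)

  2^ν₂∣ : ∀ m → 2 ^ ν₂ m ∣ m
  2^ν₂∣ zero = _ ∣0
  2^ν₂∣ m@(suc _) = go (dyadic m)
    where
    go : ∀ {m} → Dyadic m → 2 ^ ν₂ m ∣ m
    go (odd k) = subst (_∣ 1 + 2 * k) (cong (2 ^_) (sym (ν₂-odd k))) (1∣ _)
    go (double {m} dm) = subst (_∣ 2 * m) (cong (2 ^_) (sym (ν₂-double m {{dyadic-nonZero dm}}))) (*-monoʳ-∣ 2 (go dm))

  ν₂-2^ : ∀ k → ν₂ (2 ^ k) ≡ k
  ν₂-2^ zero    = refl
  ν₂-2^ (suc k) = trans (ν₂-double (2 ^ k) {{m^n≢0 2 k}}) (cong suc (ν₂-2^ k))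

  2^∣⇒≤ν₂ : ∀ {k m} .{{_ : NonZero m}} → 2 ^ k ∣ m → k ≤ ν₂ m
  2^∣⇒≤ν₂ {k} {m} 2^k∣m = begin
    k                      ≤⟨ m≤n+m k (ν₂ q) ⟩
    ν₂ q + k               ≡⟨ cong (ν₂ q +_) (ν₂-2^ k) ⟨
    ν₂ q + ν₂ (2 ^ k)      ≡⟨ ν₂-* q (2 ^ k) {{quotient≢0 2^k∣m}} {{m^n≢0 2 k}} ⟨
    ν₂ (q * 2 ^ k)         ≡⟨ cong ν₂ (m∣n⇒n≡quotient*m 2^k∣m) ⟨
    ν₂ m                   ∎
    where
    open ≤-Reasoning
    q : ℕ
    q = quotient 2^k∣m

  ν₂≤⌊log₂⌋ : ∀ m .{{_ : NonZero m}} → ν₂ m ≤ ⌊log₂ m ⌋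
  ν₂≤⌊log₂⌋ m = subst (_≤ ⌊log₂ m ⌋) (⌊log₂[2^n]⌋≡n (ν₂ m)) (⌊log₂⌋-mono-≤ (∣⇒≤ (2^ν₂∣ m)))

  ^-monoʳ-∣ : ∀ m {a b} → a ≤ b → m ^ a ∣ m ^ b
  ^-monoʳ-∣ m {a} {b} a≤b = subst (m ^ a ∣_) m^a*m^[b∸a]≡m^b (m∣m*n (m ^ (b ∸ a)))
    where
    m^a*m^[b∸a]≡m^b : m ^ a * m ^ (b ∸ a) ≡ m ^ b
    m^a*m^[b∸a]≡m^b = trans (sym (^-distribˡ-+-* m a (b ∸ a))) (cong (m ^_) (m+[n∸m]≡n a≤b))

  2^ν₂-*-pres-∣ : ∀ a b {x y} .{{_ : NonZero a}} .{{_ : NonZero b}} →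
                  2 ^ ν₂ a ∣ x → 2 ^ ν₂ b ∣ y → 2 ^ ν₂ (a * b) ∣ x * y
  2^ν₂-*-pres-∣ a b a∣x b∣y = subst (_∣ _) 2^ν₂a*2^ν₂b≡2^ν₂[a*b] (*-pres-∣ a∣x b∣y)
    where
    2^ν₂a*2^ν₂b≡2^ν₂[a*b] : 2 ^ ν₂ a * 2 ^ ν₂ b ≡ 2 ^ ν₂ (a * b)
    2^ν₂a*2^ν₂b≡2^ν₂[a*b] = trans (sym (^-distribˡ-+-* 2 (ν₂ a) (ν₂ b))) (cong (2 ^_) (sym (ν₂-* a b)))

module LeibnizTriangle where

  open Valuation

  open import Data.Nat
  open import Data.Nat.Properties
  open import Data.Nat.Divisibility
  open import Data.Nat.Logarithm using (⌊log₂_⌋; ⌊log₂⌋-mono-≤)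
  open import Data.Nat.Tactic.RingSolver using (solve-∀)
  open import Relation.Binary.PropositionalEquality

  antidiagonalSum : (ℕ → ℕ → ℕ) → ℕ → ℕ
  antidiagonalSum f zero    = f 0 0
  antidiagonalSum f (suc n) = f 0 (suc n) + antidiagonalSum (λ i j → f (suc i) j) n

  antidiagonalSum-cong : ∀ {f g} n → (∀ i j → i + j ≡ n → f i j ≡ g i j) →
                         antidiagonalSum f n ≡ antidiagonalSum g n
  antidiagonalSum-cong zero    f≡g = f≡g 0 0 refl
  antidiagonalSum-cong (suc n) f≡g =
    cong₂ _+_ (f≡g 0 (suc n) refl) (antidiagonalSum-cong n (λ i j e → f≡g (suc i) j (cong suc e)))

  antidiagonalSum-+ : ∀ f g n → antidiagonalSum (λ i j → f i j + g i j) n ≡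
                                antidiagonalSum f n + antidiagonalSum g n
  antidiagonalSum-+ f g zero    = refl
  antidiagonalSum-+ f g (suc n) = begin
    f 0 (suc n) + g 0 (suc n) + antidiagonalSum (λ i j → f (suc i) j + g (suc i) j) n
      ≡⟨ cong (f 0 (suc n) + g 0 (suc n) +_) (antidiagonalSum-+ (λ i → f (suc i)) (λ i → g (suc i)) n) ⟩
    f 0 (suc n) + g 0 (suc n) + (antidiagonalSum (λ i → f (suc i)) n + antidiagonalSum (λ i → g (suc i)) n)
      ≡⟨ +-assoc-swap (f 0 (suc n)) (g 0 (suc n)) _ _ ⟩
    antidiagonalSum f (suc n) + antidiagonalSum g (suc n) ∎
    where
    open ≡-Reasoning
    +-assoc-swap : ∀ a b c d → a + b + (c + d) ≡ a + c + (b + d)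
    +-assoc-swap = solve-∀

  *-distribˡ-antidiagonalSum : ∀ c f n → c * antidiagonalSum f n ≡ antidiagonalSum (λ i j → c * f i j) n
  *-distribˡ-antidiagonalSum c f zero    = refl
  *-distribˡ-antidiagonalSum c f (suc n) =
    trans (*-distribˡ-+ c (f 0 (suc n)) _) (cong (c * f 0 (suc n) +_) (*-distribˡ-antidiagonalSum c (λ i → f (suc i)) n))

  antidiagonalSum-suc : ∀ f n → antidiagonalSum f (suc n) ≡ antidiagonalSum (λ i j → f i (suc j)) n + f (suc n) 0
  antidiagonalSum-suc f zero    = refl
  antidiagonalSum-suc f (suc n) =
    trans (cong (f 0 (suc (suc n)) +_) (antidiagonalSum-suc (λ i → f (suc i)) n)) (sym (+-assoc (f 0 (suc (suc n))) _ _))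

  ∣-antidiagonalSum : ∀ {d f} n → (∀ i j → i + j ≡ n → d ∣ f i j) → d ∣ antidiagonalSum f n
  ∣-antidiagonalSum zero    d∣f = d∣f 0 0 refl
  ∣-antidiagonalSum (suc n) d∣f = ∣m∣n⇒∣m+n (d∣f 0 (suc n) refl) (∣-antidiagonalSum n (λ i j e → d∣f (suc i) j (cong suc e)))

  factorialConvolution : ℕ → ℕ
  factorialConvolution = antidiagonalSum (λ i j → i ! * j !)

  -- Splitting the weight, (i+j+2) i! j! = (i+1)! j! + i! (j+1)!, gives two sums over the next
  -- antidiagonal, each missing one of its boundary terms 0! (d+1)! and (d+1)! 0!.
  factorialConvolution-suc : ∀ d → (2 + d) * factorialConvolution d + 2 * suc d ! ≡
                                   2 * factorialConvolution (suc d)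
  factorialConvolution-suc d = begin
    (2 + d) * antidiagonalSum (λ i j → i ! * j !) d + 2 * suc d !
      ≡⟨ cong (_+ 2 * suc d !) (*-distribˡ-antidiagonalSum (2 + d) _ d) ⟩
    antidiagonalSum (λ i j → (2 + d) * (i ! * j !)) d + 2 * suc d !
      ≡⟨ cong (_+ 2 * suc d !) (antidiagonalSum-cong d split) ⟩
    antidiagonalSum (λ i j → suc i ! * j ! + i ! * suc j !) d + 2 * suc d !
      ≡⟨ cong (_+ 2 * suc d !) (antidiagonalSum-+ (λ i j → suc i ! * j !) (λ i j → i ! * suc j !) d) ⟩
    antidiagonalSum (λ i j → suc i ! * j !) d + antidiagonalSum (λ i j → i ! * suc j !) d + 2 * suc d !
      ≡⟨ regroup _ _ (suc d !) ⟩
    (1 * suc d ! + antidiagonalSum (λ i j → suc i ! * j !) d) + (antidiagonalSum (λ i j → i ! * suc j !) d + suc d ! * 1)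
      ≡⟨ cong (factorialConvolution (suc d) +_) (antidiagonalSum-suc (λ i j → i ! * j !) d) ⟨
    factorialConvolution (suc d) + factorialConvolution (suc d)
      ≡⟨ cong (factorialConvolution (suc d) +_) (+-identityʳ _) ⟨
    2 * factorialConvolution (suc d) ∎
    where
    open ≡-Reasoning
    split : ∀ i j → i + j ≡ d → (2 + d) * (i ! * j !) ≡ suc i ! * j ! + i ! * suc j !
    split i j refl = semiring i j (i !) (j !)
      where
      semiring : ∀ i j x y → (2 + (i + j)) * (x * y) ≡ suc i * x * y + x * (suc j * y)
      semiring = solve-∀
    regroup : ∀ a b c → a + b + 2 * c ≡ (1 * c + a) + (b + c * 1)
    regroup = solve-∀

  factorialConvolution-nonZero : ∀ d → NonZero (factorialConvolution d)
  factorialConvolution-nonZero zero    = _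
  factorialConvolution-nonZero (suc d) =
    ≢-nonZero λ F≡0 → ≢-nonZero⁻¹ (suc d !) {{suc d !≢0}} (trans (sym (*-identityˡ _)) (m+n≡0⇒m≡0 _ F≡0))

  -- 2 ^ ν₂ d ∣ 2 ^ e * x  is the integral form of  ϑ₂(x / d) ≥ −e.
  leibnizTriangle-ν₂ : ∀ i j → 2 ^ ν₂ (suc (i + j) !) ∣ 2 ^ ⌊log₂ suc (i + j) ⌋ * (i ! * j !)
  leibnizTriangle-ν₂ i zero rewrite +-identityʳ i | *-identityʳ (i !) =
    2^ν₂-*-pres-∣ (suc i) (i !) {{_}} {{i !≢0}} (^-monoʳ-∣ 2 (ν₂≤⌊log₂⌋ (suc i))) (2^ν₂∣ (i !))
  leibnizTriangle-ν₂ i (suc j) rewrite +-suc i j =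
    ∣m+n∣m⇒∣n (subst (2 ^ ν₂ (suc m !) ∣_) (split i j (2 ^ ⌊log₂ suc m ⌋) (i !) (j !)) column)
              (leibnizTriangle-ν₂ (suc i) j)
    where
    m : ℕ
    m = suc (i + j)
    column : 2 ^ ν₂ (suc m !) ∣ suc m * (2 ^ ⌊log₂ suc m ⌋ * (i ! * j !))
    column = 2^ν₂-*-pres-∣ (suc m) (m !) {{_}} {{m !≢0}} (2^ν₂∣ (suc m))
      (∣-trans (leibnizTriangle-ν₂ i j) (*-monoˡ-∣ (i ! * j !) (^-monoʳ-∣ 2 (⌊log₂⌋-mono-≤ (n≤1+n m)))))
    split : ∀ i j t x y → (2 + (i + j)) * (t * (x * y)) ≡ t * (suc i * x * y) + t * (x * (suc j * y))
    split = solve-∀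

  factorialConvolution-ν₂ : ∀ d → 2 ^ ν₂ (suc d !) ∣ 2 ^ ⌊log₂ suc d ⌋ * factorialConvolution d
  factorialConvolution-ν₂ d =
    subst (2 ^ ν₂ (suc d !) ∣_) (sym (*-distribˡ-antidiagonalSum (2 ^ ⌊log₂ suc d ⌋) (λ i j → i ! * j !) d))
          (∣-antidiagonalSum d entry)
    where
    entry : ∀ i j → i + j ≡ d → 2 ^ ν₂ (suc d !) ∣ 2 ^ ⌊log₂ suc d ⌋ * (i ! * j !)
    entry i j refl = leibnizTriangle-ν₂ i j

module HarmonicSum where

  open Valuation
  open LeibnizTriangle

  open import Data.Nat as ℕ using (ℕ; zero; suc; NonZero; _!; _^_; _∸_)
  open import Data.Nat.Properties as ℕ using (_!≢0)
  open import Data.Nat.GCD as ℕ using ()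
  open import Data.Nat.Logarithm using (⌊log₂_⌋; ⌊log₂⌋-mono-≤; ⌊log₂[2^n]⌋≡n)
  open import Data.Nat.Tactic.RingSolver using (solve-∀)
  open import Data.Integer as ℤ using (+_; ∣_∣)
  open import Data.Integer.Properties as ℤ using ()
  import Data.Integer.Tactic.RingSolver as ℤ-Solver
  open import Data.Rational as ℚ using (ℚ; _/_; ↥_; ↧ₙ_)
  open import Data.Rational.Properties as ℚ using ()
  import Data.Rational.Unnormalised as ℚᵘ
  import Data.Rational.Unnormalised.Properties as ℚᵘ
  open import Relation.Binary.PropositionalEquality

  /-+-/ : ∀ p q r s .{{_ : NonZero q}} .{{_ : NonZero s}} →
          p / q ℚ.+ r / s ≡ _/_ (p ℤ.* + s ℤ.+ r ℤ.* + q) (q ℕ.* s) {{ℕ.m*n≢0 q s}}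
  /-+-/ p q@(suc _) r s@(suc _) = ℚ.toℚᵘ-injective (begin
    ℚ.toℚᵘ (p / q ℚ.+ r / s)                  ≈⟨ ℚ.toℚᵘ-homo-+ (p / q) (r / s) ⟩
    ℚ.toℚᵘ (p / q) ℚᵘ.+ ℚ.toℚᵘ (r / s)        ≈⟨ ℚᵘ.+-cong (ℚ.toℚᵘ-fromℚᵘ (p ℚᵘ./ q)) (ℚ.toℚᵘ-fromℚᵘ (r ℚᵘ./ s)) ⟩
    p ℚᵘ./ q ℚᵘ.+ r ℚᵘ./ s                    ≈⟨ ℚ.toℚᵘ-fromℚᵘ (p ℚᵘ./ q ℚᵘ.+ r ℚᵘ./ s) ⟨
    ℚ.toℚᵘ (ℚ.fromℚᵘ (p ℚᵘ./ q ℚᵘ.+ r ℚᵘ./ s)) ∎)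
    where open ℚᵘ.≃-Reasoning

  ν₂ℚ-/ : ∀ x d .{{_ : NonZero x}} .{{_ : NonZero d}} → ν₂ℚ (+ x / d) ≡ + ν₂ x ℤ.- + ν₂ d
  ν₂ℚ-/ x@(suc _) d@(suc _) = begin
    ν₂ℚ (+ x / d)
      ≡⟨⟩
    + ν₂ a ℤ.- + ν₂ b
      ≡⟨ cancel (+ ν₂ a) (+ ν₂ g) (+ ν₂ b) ⟨
    (+ ν₂ a ℤ.+ + ν₂ g) ℤ.- (+ ν₂ b ℤ.+ + ν₂ g)
      ≡⟨ cong₂ ℤ._-_ (ℤ.pos-+ (ν₂ a) (ν₂ g)) (ℤ.pos-+ (ν₂ b) (ν₂ g)) ⟨
    + (ν₂ a ℕ.+ ν₂ g) ℤ.- + (ν₂ b ℕ.+ ν₂ g)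
      ≡⟨ cong₂ (λ u v → + u ℤ.- + v) (ν₂-* a g) (ν₂-* b g) ⟨
    + ν₂ (a ℕ.* g) ℤ.- + ν₂ (b ℕ.* g)
      ≡⟨ cong₂ (λ u v → + ν₂ u ℤ.- + ν₂ v) a*g≡x b*g≡d ⟩
    + ν₂ x ℤ.- + ν₂ d ∎
    where
    open ≡-Reasoning
    q : ℚ
    q = + x / d
    a b g : ℕ
    a = ∣ ↥ q ∣
    b = ↧ₙ q
    g = ℕ.gcd x d
    a*g≡x : a ℕ.* g ≡ x
    a*g≡x = trans (sym (ℤ.abs-* (↥ q) (+ g))) (cong ∣_∣ (ℚ.↥-/ (+ x) d))
    b*g≡d : b ℕ.* g ≡ d
    b*g≡d = ℤ.+-injective (trans (ℤ.pos-* b g) (ℚ.↧-/ (+ x) d))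
    instance
      a≢0 : NonZero a
      a≢0 = ℕ.m*n≢0⇒m≢0 a {{subst NonZero (sym a*g≡x) _}}
      g≢0 : NonZero g
      g≢0 = ℕ.m*n≢0⇒n≢0 a {{subst NonZero (sym a*g≡x) _}}
      b≢0 : NonZero b
      b≢0 = ℕ.m*n≢0⇒m≢0 b {{subst NonZero (sym b*g≡d) _}}
    cancel : ∀ u w v → (u ℤ.+ w) ℤ.- (v ℤ.+ w) ≡ u ℤ.- v
    cancel = ℤ-Solver.solve-∀

  S-closedForm : ∀ d → S (suc d) ≡ _/_ (+ (2 ^ suc d ℕ.* factorialConvolution d)) (suc d !) {{suc d !≢0}}
  S-closedForm zero    = ℚ.+-identityˡ (term 0)
  S-closedForm (suc d) = begin
    S (suc d) ℚ.+ term (suc d)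
      ≡⟨ cong (ℚ._+ term (suc d)) (S-closedForm d) ⟩
    + a / suc d ! ℚ.+ + b / suc (suc d)
      ≡⟨ /-+-/ (+ a) (suc d !) (+ b) (suc (suc d)) ⟩
    (+ a ℤ.* + suc (suc d) ℤ.+ + b ℤ.* + (suc d !)) / (suc d ! ℕ.* suc (suc d))
      ≡⟨ ℚ./-cong numerator (ℕ.*-comm (suc d !) (suc (suc d))) ⟩
    + (2 ^ suc (suc d) ℕ.* factorialConvolution (suc d)) / suc (suc d) ! ∎
    where
    open ≡-Reasoning
    instance
      _ : ℕ.NonZero (suc d !)
      _ = suc d !≢0
      _ : ℕ.NonZero (suc (suc d) !)
      _ = suc (suc d) !≢0
      _ : ℕ.NonZero (suc d ! ℕ.* suc (suc d))
      _ = ℕ.m*n≢0 (suc d !) (suc (suc d))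
    a b : ℕ
    a = 2 ^ suc d ℕ.* factorialConvolution d
    b = 2 ^ suc (suc d)
    numerator : + a ℤ.* + suc (suc d) ℤ.+ + b ℤ.* + (suc d !) ≡ + (2 ^ suc (suc d) ℕ.* factorialConvolution (suc d))
    numerator = begin
      + a ℤ.* + suc (suc d) ℤ.+ + b ℤ.* + (suc d !)
        ≡⟨ cong₂ ℤ._+_ (ℤ.pos-* a (suc (suc d))) (ℤ.pos-* b (suc d !)) ⟨
      + (a ℕ.* suc (suc d)) ℤ.+ + (b ℕ.* suc d !)
        ≡⟨ ℤ.pos-+ (a ℕ.* suc (suc d)) (b ℕ.* suc d !) ⟨
      + (a ℕ.* suc (suc d) ℕ.+ b ℕ.* suc d !)
        ≡⟨ cong +_ (regroup (2 ^ suc d) (factorialConvolution d) (suc (suc d)) (suc d !)) ⟩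
      + (2 ^ suc d ℕ.* ((2 ℕ.+ d) ℕ.* factorialConvolution d ℕ.+ 2 ℕ.* suc d !))
        ≡⟨ cong (λ x → + (2 ^ suc d ℕ.* x)) (factorialConvolution-suc d) ⟩
      + (2 ^ suc d ℕ.* (2 ℕ.* factorialConvolution (suc d)))
        ≡⟨ cong +_ (swap (2 ^ suc d) (factorialConvolution (suc d))) ⟨
      + (2 ^ suc (suc d) ℕ.* factorialConvolution (suc d)) ∎
      where
      regroup : ∀ p f c g → p ℕ.* f ℕ.* c ℕ.+ 2 ℕ.* p ℕ.* g ≡ p ℕ.* (c ℕ.* f ℕ.+ 2 ℕ.* g)
      regroup = solve-∀
      swap : ∀ p f → 2 ℕ.* p ℕ.* f ≡ p ℕ.* (2 ℕ.* f)
      swap = solve-∀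

  n<2^n : ∀ n → n ℕ.< 2 ^ n
  n<2^n zero    = ℕ.s≤s ℕ.z≤n
  n<2^n (suc n) = ℕ.≤-trans (ℕ.+-mono-≤ (ℕ.m^n>0 2 n) (n<2^n n))
                            (ℕ.≤-reflexive (cong (2 ^ n ℕ.+_) (sym (ℕ.+-identityʳ (2 ^ n)))))

  ⌊log₂⌋≤id : ∀ n → ⌊log₂ n ⌋ ℕ.≤ n
  ⌊log₂⌋≤id n = subst (⌊log₂ n ⌋ ℕ.≤_) (⌊log₂[2^n]⌋≡n n) (⌊log₂⌋-mono-≤ (ℕ.<⇒≤ (n<2^n n)))

  ν₂ℚ-S-lowerBound : ∀ d → + (suc d ∸ ⌊log₂ suc d ⌋) ℤ.≤ ν₂ℚ (S (suc d))
  ν₂ℚ-S-lowerBound d = begin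
    + (n ∸ L)                      ≤⟨ ℤ.+≤+ n∸L≤n+f∸v ⟩
    + (n ℕ.+ f ∸ v)                ≡⟨ trans (ℤ.m-n≡m⊖n (n ℕ.+ f) v) (ℤ.⊖-≥ v≤n+f) ⟨
    + (n ℕ.+ f) ℤ.- + v            ≡⟨ cong (λ x → + x ℤ.- + v) (ν₂[2^k*F] n) ⟨
    + ν₂ (2 ^ n ℕ.* F) ℤ.- + v     ≡⟨ ν₂ℚ-/ (2 ^ n ℕ.* F) (n !) ⟨
    ν₂ℚ (+ (2 ^ n ℕ.* F) / n !)    ≡⟨ cong ν₂ℚ (S-closedForm d) ⟨
    ν₂ℚ (S n)                      ∎
    where
    open ℤ.≤-Reasoning
    n L F f v : ℕ
    n = suc d
    L = ⌊log₂ n ⌋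
    F = factorialConvolution d
    f = ν₂ F
    v = ν₂ (n !)
    instance
      _ : ℕ.NonZero (n !)
      _ = n !≢0
      _ : ℕ.NonZero F
      _ = factorialConvolution-nonZero d
      _ : ℕ.NonZero (2 ^ n ℕ.* F)
      _ = ℕ.m*n≢0 (2 ^ n) F {{ℕ.m^n≢0 2 n}}
    ν₂[2^k*F] : ∀ k → ν₂ (2 ^ k ℕ.* F) ≡ k ℕ.+ f
    ν₂[2^k*F] k = trans (ν₂-* (2 ^ k) F {{ℕ.m^n≢0 2 k}}) (cong (ℕ._+ f) (ν₂-2^ k))
    v≤L+f : v ℕ.≤ L ℕ.+ f
    v≤L+f = subst (v ℕ.≤_) (ν₂[2^k*F] L) (2^∣⇒≤ν₂ {{ℕ.m*n≢0 (2 ^ L) F {{ℕ.m^n≢0 2 L}}}} (factorialConvolution-ν₂ d))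
    v≤n+f : v ℕ.≤ n ℕ.+ f
    v≤n+f = ℕ.≤-trans v≤L+f (ℕ.+-monoˡ-≤ f (⌊log₂⌋≤id n))
    n∸L≤n+f∸v : n ∸ L ℕ.≤ n ℕ.+ f ∸ v
    n∸L≤n+f∸v = ℕ.≤-trans (ℕ.≤-reflexive n∸L≡) (ℕ.∸-monoʳ-≤ (n ℕ.+ f) v≤L+f)
      where
      n∸L≡ : n ∸ L ≡ n ℕ.+ f ∸ (L ℕ.+ f)
      n∸L≡ = trans (sym (ℕ.[m+n]∸[m+o]≡n∸o f n L)) (cong₂ _∸_ (ℕ.+-comm f n) (ℕ.+-comm f L))

module BinaryDigits where

  open import Data.Nat
  open import Data.Nat.Properties
  open import Data.Nat.DivMod
  open import Data.Nat.Logarithm using (⌊log₂_⌋; ⌊log₂⌋-mono-≤; ⌊log₂[2^n]⌋≡n; ⌊log₂⌊n/2⌋⌋≡⌊log₂n⌋∸1)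
  open import Data.Nat.Tactic.RingSolver using (solve-∀)
  open import Function using (_∘_)
  open import Relation.Binary.PropositionalEquality

  s₂-fuel-zero : ∀ f → s₂-fuel f 0 ≡ 0
  s₂-fuel-zero zero    = refl
  s₂-fuel-zero (suc f) = s₂-fuel-zero f

  ⌊n/2⌋≡n/2 : ∀ n → ⌊ n /2⌋ ≡ n / 2
  ⌊n/2⌋≡n/2 0        = refl
  ⌊n/2⌋≡n/2 1        = refl
  ⌊n/2⌋≡n/2 (2+ n) = trans (cong suc (⌊n/2⌋≡n/2 n)) (sym (m/n≡1+[m∸n]/n {2+ n} {2} (s≤s (s≤s z≤n))))

  ⌊log₂⌋-half : ∀ n → ⌊log₂ 2+ n ⌋ ≡ suc ⌊log₂ (2+ n) / 2 ⌋
  ⌊log₂⌋-half n = begin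
    ⌊log₂ 2+ n ⌋           ≡⟨ suc-pred ⌊log₂ 2+ n ⌋ {{>-nonZero 1≤⌊log₂⌋}} ⟨
    suc (⌊log₂ 2+ n ⌋ ∸ 1) ≡⟨ cong suc (⌊log₂⌊n/2⌋⌋≡⌊log₂n⌋∸1 (2+ n)) ⟨
    suc ⌊log₂ ⌊ 2+ n /2⌋ ⌋ ≡⟨ cong (suc ∘ ⌊log₂_⌋) (⌊n/2⌋≡n/2 (2+ n)) ⟩
    suc ⌊log₂ (2+ n) / 2 ⌋ ∎
    where
    open ≡-Reasoning
    1≤⌊log₂⌋ : 1 ≤ ⌊log₂ 2+ n ⌋
    1≤⌊log₂⌋ = subst (_≤ ⌊log₂ 2+ n ⌋) (⌊log₂[2^n]⌋≡n 1) (⌊log₂⌋-mono-≤ {2} {2+ n} (s≤s (s≤s z≤n)))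

  s₂-fuel+⌊log₂⌋≤ : ∀ f m .{{_ : NonZero m}} → m ≤ f → s₂-fuel f m + ⌊log₂ m ⌋ ≤ m
  s₂-fuel+⌊log₂⌋≤ (suc f) 1        _     = ≤-reflexive (cong₂ _+_ (cong suc (s₂-fuel-zero f)) (⌊log₂[2^n]⌋≡n 0))
  s₂-fuel+⌊log₂⌋≤ (suc f) m@(2+ k) m≤1+f = begin
    m % 2 + s₂-fuel f h + ⌊log₂ m ⌋       ≡⟨ cong (m % 2 + s₂-fuel f h +_) (⌊log₂⌋-half k) ⟩
    m % 2 + s₂-fuel f h + suc ⌊log₂ h ⌋   ≡⟨ regroup (m % 2) (s₂-fuel f h) ⌊log₂ h ⌋ ⟩
    m % 2 + suc (s₂-fuel f h + ⌊log₂ h ⌋) ≤⟨ +-monoʳ-≤ (m % 2) (s≤s (s₂-fuel+⌊log₂⌋≤ f h h≤f)) ⟩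
    m % 2 + suc h                         ≤⟨ +-monoʳ-≤ (m % 2) (1+n≤n*2 h) ⟩
    m % 2 + h * 2                         ≡⟨ m≡m%n+[m/n]*n m 2 ⟨
    m                                     ∎
    where
    open ≤-Reasoning
    h : ℕ
    h = m / 2
    instance
      h≢0 : NonZero h
      h≢0 = >-nonZero (m≥n⇒m/n>0 {m} {2} (s≤s (s≤s z≤n)))
    h≤f : h ≤ f
    h≤f = <⇒≤pred (<-≤-trans (m/n<m m 2 (s≤s (s≤s z≤n))) m≤1+f)
    1+n≤n*2 : ∀ n .{{_ : NonZero n}} → suc n ≤ n * 2
    1+n≤n*2 (suc n) = s≤s (s≤s (m≤m*n n 2))
    regroup : ∀ r s l → r + s + suc l ≡ r + suc (s + l)
    regroup = solve-∀

  s₂+⌊log₂⌋≤ : ∀ n .{{_ : NonZero n}} → s₂ n + ⌊log₂ n ⌋ ≤ n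
  s₂+⌊log₂⌋≤ n = s₂-fuel+⌊log₂⌋≤ n n ≤-refl

open import Data.Nat using (ℕ; NonZero; _∸_)
open import Data.Nat.Logarithm using (⌊log₂_⌋)
open import Data.Integer using (+_; _≤_)
open import Data.Product using (_×_)

open import Data.Nat as ℕ using (suc)
open import Data.Nat.Properties using (m+n≤o⇒m≤o∸n)
open import Data.Integer using (+≤+)
open import Data.Integer.Properties using (≤-trans)
open import Data.Product using (_,_)
open HarmonicSum using (ν₂ℚ-S-lowerBound)
open BinaryDigits using (s₂+⌊log₂⌋≤)

theorem2 : (n : ℕ) → .{{_ : NonZero n}} →
    (+ s₂ n ≤ ν₂ℚ (S n)) × (+ (n ∸ ⌊log₂ n ⌋) ≤ ν₂ℚ (S n))
theorem2 n@(suc d) = ≤-trans (+≤+ s₂≤n∸⌊log₂n⌋) (ν₂ℚ-S-lowerBound d) , ν₂ℚ-S-lowerBound d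
  where
  s₂≤n∸⌊log₂n⌋ : s₂ n ℕ.≤ n ∸ ⌊log₂ n ⌋
  s₂≤n∸⌊log₂n⌋ = m+n≤o⇒m≤o∸n (s₂ n) (s₂+⌊log₂⌋≤ n)
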